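{- Let $n\geq k\geq 1$ and let $S\neq T$ be $k$-subsets of $[n]$. The set of vertices of degree one in the multigraph $h(S,T)$ equals $S\Delta T$. Consequently, the number of path components of $h(S,T)$ equals $\frac{|S\Delta T|}{2}=|S\setminus T|=|T\setminus S|$.
   Context: $[m]=\{1,\dots,m\}$. For a $k$-subset $S$ of $[n]$ define $f(S)\subseteq([n]\setminus[k])\times[k]$: if $S=[k]$ then $f(S)=\emptyset$; otherwise let $S\setminus[k]=\{x_1,\dots,x_t\}$ with $n\geq x_1>\dots>x_t\geq k+1$ and $[k]\setminus S=\{y_1,\dots,y_t\}$ with $1\leq y_1<\dots<y_t\leq k$, and set $f(S)=\{(x_1,y_1),\dots,(x_t,y_t)\}$. Let $h(S)$ be the graph on vertex set $[n]$ whose edges are the pairs $\{x,y\}$ with $(x,y)\in f(S)$, and let $h(S,T)$ be the multigraph on $[n]$ that is the union of $h(S)$ and $h(T)$ (a pair in $f(S)\cap f(T)$ gives a double edge). A path component is a connected component of $h(S,T)$ which is a path with at least one edge. -}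

module Defs where

open import Data.Nat using (ℕ; zero; suc; _+_; _<_; _≥_; _<?_; _≤?_)
open import Data.Fin using (Fin; toℕ)
open import Data.Fin.Properties using (_≟_)
open import Data.Fin.Subset using (Subset; _∈_; _∉_; _─_; _∪_)
open import Data.Fin.Subset.Properties using (_∈?_)
open import Data.List using (List; []; _∷_; filter; reverse; zip; length; _++_; map)
open import Data.List.Base using (allFin)
open import Data.Product using (_×_; _,_; proj₁; proj₂; Σ)
open import Relation.Nullary using (Dec; yes; no; ¬_; ¬?)
open import Relation.Nullary.Decidable using (_×-dec_)
open import Relation.Binary.PropositionalEquality using (_≡_)
open import Data.List.Relation.Unary.Unique.Propositional using (Unique)
open import Data.List.Relation.Binary.Permutation.Propositional using (_↭_)
open import Function.Bundles using (_⇔_)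
import Data.List.Membership.Propositional as LM

-- Convention: the ground set [n] = {1,…,n} is represented by Fin n,
-- where i : Fin n stands for the number toℕ i + 1.
-- Hence [k] corresponds to {i | toℕ i < k}.

Edge : ℕ → Set
Edge n = Fin n × Fin n

-- S ∖ [k], listed in decreasing order  x₁ > … > x_t
upperPart : ∀ {n} (k : ℕ) → Subset n → List (Fin n)
upperPart {n} k S =
  reverse (filter (λ i → (i ∈? S) ×-dec (k ≤? toℕ i)) (allFin n))

-- [k] ∖ S, listed in increasing order  y₁ < … < y_t
lowerPart : ∀ {n} (k : ℕ) → Subset n → List (Fin n)
lowerPart {n} k S =
  filter (λ i → ¬? (i ∈? S) ×-dec (toℕ i <? k)) (allFin n)

f : ∀ {n} (k : ℕ) → Subset n → List (Edge n)
f k S = zip (upperPart k S) (lowerPart k S)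

hEdges : ∀ {n} (k : ℕ) → Subset n → Subset n → List (Edge n)
hEdges k S T = f k S ++ f k T

degree : ∀ {n} → List (Edge n) → Fin n → ℕ
degree E v = length (filter (λ e → proj₁ e ≟ v) E)
           + length (filter (λ e → proj₂ e ≟ v) E)

_Δ_ : ∀ {n} → Subset n → Subset n → Subset n
S Δ T = (S ─ T) ∪ (T ─ S)

data Reach {n} (E : List (Edge n)) (u : Fin n) : Fin n → Set where
  here  : Reach E u u
  fwd   : ∀ {v w} → Reach E u v → (v , w) LM.∈ E → Reach E u w
  bwd   : ∀ {v w} → Reach E u v → (w , v) LM.∈ E → Reach E u w

IsComponent : ∀ {n} → List (Edge n) → Subset n → Set
IsComponent {n} E C = Σ (Fin n) λ v → ∀ w → (w ∈ C ⇔ Reach E v w)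

-- edges of E lying in the component C (an edge lies in a component iff
-- its first endpoint does)
edgesIn : ∀ {n} → List (Edge n) → Subset n → List (Edge n)
edgesIn E C = filter (λ e → proj₁ e ∈? C) E

-- unordered edge normalisation: larger endpoint first
norm : ∀ {n} → Edge n → Edge n
norm (a , b) with toℕ b ≤? toℕ a
... | yes _ = (a , b)
... | no  _ = (b , a)

consecutive : ∀ {n} → List (Fin n) → List (Edge n)
consecutive (a ∷ b ∷ rest) = (a , b) ∷ consecutive (b ∷ rest)
consecutive _ = []

IsPathOn : ∀ {n} → List (Edge n) → Subset n → Set
IsPathOn {n} E C = Σ (List (Fin n)) λ vs →
    (length vs ≥ 2)
  × Unique vs
  × (∀ w → (w ∈ C ⇔ w LM.∈ vs))
  × (map norm (edgesIn E C) ↭ map norm (consecutive vs))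

IsPathComponent : ∀ {n} → List (Edge n) → Subset n → Set
IsPathComponent E C = IsComponent E C × IsPathOn E C

-- f(S) zips S ∖ [k] with [k] ∖ S; when |S| = k both lists have k − |S ∩ [k]| elements, so h(S)
-- is a matching covering exactly the vertices that lie in exactly one of S and [k]. Hence a vertex
-- has degree one in h(S,T) = h(S) ∪ h(T) iff it lies in exactly one of S and T. In a union of two
-- matchings, the walk that starts at a degree-one vertex and alternates between the matchings
-- traces its whole component as a path ending at another degree-one vertex, and the endpoints of
-- any path component have degree one. So path components pair up the vertices of S Δ T, and
-- |S ∖ T| = |T ∖ S| because |S| = |T|.

module Submission where

open import Defs
open import Level using (Level)
open import Algebra.Properties.CommutativeSemigroup using (interchange)
open import Data.Bool using (Bool; true; false; not; _∧_; _xor_; if_then_else_)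
import Data.Bool as Bool
open import Data.Empty using (⊥; ⊥-elim)
open import Data.Fin as Fin using (Fin; toℕ)
open import Data.Fin.Properties using (toℕ-injective) renaming (_≟_ to _≟ᶠ_)
open import Data.Fin.Subset using (Subset; inside; outside; _∈_; _∉_; _⊆_; ∣_∣; _─_; _∪_; _∩_; ⁅_⁆)
import Data.Fin.Subset as Subset
open import Data.Fin.Subset.Properties
  using ( _∈?_; drop-there; x∈p∪q⁺; x∈p∪q⁻; x∈p∧x∉q⇒x∈p─q; p─q⊆p; ∩-comm; ∉⊥; x∈⁅x⁆; x∈⁅y⁆⇒x≡y
        ; ⊆-antisym)
open import Data.List using (List; []; _∷_; length; filter; map; _++_; allFin; tabulate; reverse; zip)
open import Data.List.Membership.Propositional using () renaming (_∈_ to _∈ₗ_; _∉_ to _∉ₗ_)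
import Data.List.Membership.Propositional as LM
import Data.List.Membership.DecPropositional as DecMembership
open import Data.List.Membership.Propositional.Properties
  using (∈-filter⁺; ∈-filter⁻; ∈-map⁺; ∈-map⁻; ∈-++⁺ˡ; ∈-++⁺ʳ; ∈-++⁻; ∈-allFin; ∈-length)
open import Data.List.Membership.Propositional.Properties.WithK using (unique∧set⇒bag)
open import Data.List.Properties
  using (length-map; length-++; length-reverse; length-tabulate; length-filter; filter-none; filter-≐; filter-++; map-++)
open import Data.List.Relation.Binary.BagAndSetEquality using (∼bag⇒↭)
open import Data.List.Relation.Binary.Permutation.Propositional using (_↭_; ↭-sym; ↭⇒↭ₛ)
open import Data.List.Relation.Binary.Permutation.Propositional.Properties
  using (↭-length; ∈-resp-↭; filter-↭; ↭-reverse)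
import Data.List.Relation.Binary.Permutation.Setoid.Properties as PermutationSetoid
open import Data.List.Relation.Unary.All as All using ()
open import Data.List.Relation.Unary.AllPairs using ([]; _∷_)
open import Data.List.Relation.Unary.Any using (here; there)
open import Data.List.Relation.Unary.Unique.Propositional using (Unique)
import Data.List.Relation.Unary.Unique.Propositional.Properties as Unique
open import Data.Nat using (ℕ; zero; suc; _+_; _*_; _≤_; _<_; _≤?_; _<?_; z≤n; s≤s) renaming (_≟_ to _≟ℕ_)
open import Data.Nat.Properties
  using ( module ≤-Reasoning; ≤-refl; ≤-trans; ≤-antisym; ≤-reflexive; ≤-pred; n≤1+n; m≤m+n; m≤n+m
        ; <-irrefl; <-asym; <⇒≱; ≤⇒≯; ≮⇒≥; ≰⇒≥; ≤∧≢⇒<; +-mono-≤; +-suc; +-identityʳ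
        ; 1+n≢0; +-cancelˡ-≡; +-cancelʳ-≡; *-comm; *-cancelʳ-≡; +-commutativeSemigroup)
open import Data.Product using (_×_; _,_; proj₁; proj₂; ∃; Σ; map₂; swap)
open import Data.Sum using (_⊎_; inj₁; inj₂; [_,_]′)
open import Function using (id; _∘_; flip)
open import Function.Bundles using (_⇔_; mk⇔; Equivalence)
import Function.Properties.Equivalence as ⇔
open import Relation.Binary.PropositionalEquality
open import Relation.Nullary using (Dec; yes; no; does; ¬_; ¬?)
open import Relation.Nullary.Decidable using (_×-dec_; dec-true; dec-false)
import Relation.Nullary.Decidable as Dec
open import Relation.Unary using (Pred; Decidable)
import Data.Vec as Vec

private
  variable
    a p q : Level
    A B : Set a
    n : ℕ

Unique-∷ : ∀ {x : A} {xs} → x ∉ₗ xs → Unique xs → Unique (x ∷ xs)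
Unique-∷ {xs = xs} x∉xs u = All.tabulate (λ y∈xs x≡y → x∉xs (subst (_∈ₗ xs) (sym x≡y) y∈xs)) ∷ u

Unique-resp-↭ : ∀ {xs ys : List A} → xs ↭ ys → Unique xs → Unique ys
Unique-resp-↭ {A = A} xs↭ys = PermutationSetoid.Unique-resp-↭ (setoid A) (↭⇒↭ₛ xs↭ys)

Unique-map⁺-on : (f : A → B) {xs : List A} →
  (∀ {x y} → x ∈ₗ xs → y ∈ₗ xs → f x ≡ f y → x ≡ y) → Unique xs → Unique (map f xs)
Unique-map⁺-on f {[]} inj u = []
Unique-map⁺-on f {x ∷ xs} inj u@(_ ∷ uxs) =
  Unique-∷ fx∉ (Unique-map⁺-on f (λ p q → inj (there p) (there q)) uxs)
  where
  fx∉ : f x ∉ₗ map f xs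
  fx∉ fx∈ with ∈-map⁻ f fx∈
  ... | y , y∈xs , fx≡fy with inj (here refl) (there y∈xs) fx≡fy
  ...   | refl = Unique.Unique[x∷xs]⇒x∉xs u y∈xs

Unique-sameMembers⇒↭ : ∀ {xs ys : List A} → Unique xs → Unique ys →
  (∀ {x} → x ∈ₗ xs → x ∈ₗ ys) → (∀ {x} → x ∈ₗ ys → x ∈ₗ xs) → xs ↭ ys
Unique-sameMembers⇒↭ u v to from = ∼bag⇒↭ (unique∧set⇒bag u v (mk⇔ to from))

Unique⇒length≤ : ∀ {xs : List (Fin n)} → Unique xs → length xs ≤ n
Unique⇒length≤ {n} {xs} u = begin
  length xs                       ≡⟨ ↭-length xs↭ ⟩
  length (filter ∈xs? (allFin n)) ≤⟨ length-filter ∈xs? (allFin n) ⟩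
  length (allFin n)               ≡⟨ length-tabulate id ⟩
  n                               ∎
  where
  open ≤-Reasoning
  ∈xs? : Decidable (_∈ₗ xs)
  ∈xs? i = DecMembership._∈?_ _≟ᶠ_ i xs
  xs↭ : xs ↭ filter ∈xs? (allFin n)
  xs↭ = Unique-sameMembers⇒↭ u (Unique.filter⁺ ∈xs? (Unique.allFin⁺ n))
          (λ {x} x∈ → ∈-filter⁺ ∈xs? (∈-allFin x) x∈) (λ x∈ → proj₂ (∈-filter⁻ ∈xs? {xs = allFin n} x∈))

Unique-++⇒disjoint : ∀ (xs : List A) {ys z} → Unique (xs ++ ys) → z ∈ₗ xs → z ∉ₗ ys
Unique-++⇒disjoint (x ∷ xs) u (here refl) z∈ys = Unique.Unique[x∷xs]⇒x∉xs u (∈-++⁺ʳ xs z∈ys)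
Unique-++⇒disjoint (x ∷ xs) (_ ∷ u) (there z∈xs) = Unique-++⇒disjoint xs u z∈xs

module _ {P : Pred A p} (P? : Decidable P) where

  length-filter-∷ : ∀ x xs → length (filter P? xs) ≤ length (filter P? (x ∷ xs))
  length-filter-∷ x xs with P? x
  ... | yes _ = n≤1+n _
  ... | no _  = ≤-refl

  1≤length-filter : ∀ {x xs} → x ∈ₗ xs → P x → 1 ≤ length (filter P? xs)
  1≤length-filter x∈xs Px = ∈-length (∈-filter⁺ P? x∈xs Px)

  2≤length-filter : ∀ {x y xs} → x ∈ₗ xs → y ∈ₗ xs → x ≢ y → P x → P y → 2 ≤ length (filter P? xs)
  2≤length-filter (here refl) (here refl) x≢y _ _ = ⊥-elim (x≢y refl)
  2≤length-filter {x} (here refl) (there y∈xs) _ Px Py with P? x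
  ... | yes _  = s≤s (1≤length-filter y∈xs Py)
  ... | no ¬Px = ⊥-elim (¬Px Px)
  2≤length-filter {y = y} (there x∈xs) (here refl) _ Px Py with P? y
  ... | yes _  = s≤s (1≤length-filter x∈xs Px)
  ... | no ¬Py = ⊥-elim (¬Py Py)
  2≤length-filter {xs = z ∷ xs} (there x∈xs) (there y∈xs) x≢y Px Py =
    ≤-trans (2≤length-filter x∈xs y∈xs x≢y Px Py) (length-filter-∷ z xs)

m*2≡m+m : ∀ m → m * 2 ≡ m + m
m*2≡m+m m = trans (*-comm m 2) (cong (m +_) (+-identityʳ m))

module _ {P : Pred A p} {Q : Pred A q} (P? : Decidable P) (Q? : Decidable Q) where

  length-filter-split : ∀ xs → length (filter P? xs) ≡
    length (filter (λ x → P? x ×-dec Q? x) xs) + length (filter (λ x → P? x ×-dec ¬? (Q? x)) xs)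
  length-filter-split [] = refl
  length-filter-split (x ∷ xs) with P? x | Q? x
  ... | yes _ | yes _ = cong suc (length-filter-split xs)
  ... | yes _ | no _  = trans (cong suc (length-filter-split xs)) (sym (+-suc _ _))
  ... | no _  | _     = length-filter-split xs

length-filter-tabulate : ∀ {m} {P : Pred A p} (P? : Decidable P) (g : Fin m → A) →
  length (filter P? (tabulate g)) ≡ length (filter (λ i → P? (g i)) (allFin m))
length-filter-tabulate {m = zero} P? g = refl
length-filter-tabulate {m = suc m} P? g with P? (g Fin.zero)
... | yes _ = cong suc (trans (length-filter-tabulate P? (g ∘ Fin.suc))
                              (sym (length-filter-tabulate (λ i → P? (g i)) Fin.suc)))
... | no _  = trans (length-filter-tabulate P? (g ∘ Fin.suc))
                    (sym (length-filter-tabulate (λ i → P? (g i)) Fin.suc))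

length-filter-∈-tabulate-suc : ∀ s (S : Subset n) →
  length (filter (_∈? (s Vec.∷ S)) (tabulate Fin.suc)) ≡ length (filter (_∈? S) (allFin n))
length-filter-∈-tabulate-suc {n} s S = begin
  length (filter (_∈? (s Vec.∷ S)) (tabulate Fin.suc))
    ≡⟨ length-filter-tabulate (_∈? (s Vec.∷ S)) Fin.suc ⟩
  length (filter (λ i → Fin.suc i ∈? (s Vec.∷ S)) (allFin n))
    ≡⟨ cong length (filter-≐ _ (_∈? S) (drop-there , Vec.there) (allFin n)) ⟩
  length (filter (_∈? S) (allFin n)) ∎
  where open ≡-Reasoning

∣p∣≡length-filter-∈ : (S : Subset n) → ∣ S ∣ ≡ length (filter (_∈? S) (allFin n))
∣p∣≡length-filter-∈ Vec.[] = refl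
∣p∣≡length-filter-∈ (inside Vec.∷ S) =
  cong suc (trans (∣p∣≡length-filter-∈ S) (sym (length-filter-∈-tabulate-suc inside S)))
∣p∣≡length-filter-∈ (outside Vec.∷ S) =
  trans (∣p∣≡length-filter-∈ S) (sym (length-filter-∈-tabulate-suc outside S))

length-filter-<-allFin : ∀ k → k ≤ n → length (filter (λ i → toℕ i <? k) (allFin n)) ≡ k
length-filter-<-allFin {n} zero _ =
  cong length (filter-none (λ i → toℕ i <? 0) {allFin n} (All.tabulate (λ _ ())))
length-filter-<-allFin {suc n} (suc k) (s≤s k≤n) = cong suc (begin
  length (filter (λ i → toℕ i <? suc k) (tabulate (Fin.suc {n})))
    ≡⟨ length-filter-tabulate (λ i → toℕ i <? suc k) (Fin.suc {n}) ⟩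
  length (filter (λ i → toℕ (Fin.suc i) <? suc k) (allFin n))
    ≡⟨ cong length (filter-≐ _ _ (≤-pred , s≤s) (allFin n)) ⟩
  length (filter (λ i → toℕ i <? k) (allFin n))
    ≡⟨ length-filter-<-allFin k k≤n ⟩
  k ∎)
  where open ≡-Reasoning

occurrences : Fin n → List (Fin n) → ℕ
occurrences v xs = length (filter (_≟ᶠ v) xs)

occurrences-∉ : ∀ {v : Fin n} {xs} → v ∉ₗ xs → occurrences v xs ≡ 0
occurrences-∉ {v = v} v∉xs =
  cong length (filter-none (_≟ᶠ v) (All.tabulate (λ x∈xs x≡v → v∉xs (subst (_∈ₗ _) x≡v x∈xs))))

occurrences-Unique-∈ : ∀ {v : Fin n} {xs} → Unique xs → v ∈ₗ xs → occurrences v xs ≡ 1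
occurrences-Unique-∈ {v = v} {x ∷ xs} u v∈ with x ≟ᶠ v
occurrences-Unique-∈ {v = v} {x ∷ xs} u v∈         | yes refl = cong suc (occurrences-∉ (Unique.Unique[x∷xs]⇒x∉xs u))
occurrences-Unique-∈ {v = v} {x ∷ xs} u (here refl) | no x≢v   = ⊥-elim (x≢v refl)
occurrences-Unique-∈ {v = v} {x ∷ xs} (_ ∷ u) (there v∈) | no _ = occurrences-Unique-∈ u v∈

indicator : Bool → ℕ
indicator b = if b then 1 else 0

occurrences-filter-allFin : ∀ {P : Pred (Fin n) p} (P? : Decidable P) v →
  occurrences v (filter P? (allFin n)) ≡ indicator (does (P? v))
occurrences-filter-allFin {n} P? v with P? v
... | yes Pv = occurrences-Unique-∈ (Unique.filter⁺ P? (Unique.allFin⁺ n)) (∈-filter⁺ P? (∈-allFin v) Pv)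
... | no ¬Pv = occurrences-∉ (λ v∈ → ¬Pv (proj₂ (∈-filter⁻ P? {xs = allFin n} v∈)))

occurrences-reverse : ∀ (v : Fin n) xs → occurrences v (reverse xs) ≡ occurrences v xs
occurrences-reverse v xs = ↭-length (filter-↭ (_≟ᶠ v) (↭-reverse xs))

length-filter≡∣p∣ : ∀ {P : Pred (Fin n) p} (P? : Decidable P) (D : Subset n) →
  (∀ v → P v ⇔ v ∈ D) → length (filter P? (allFin n)) ≡ ∣ D ∣
length-filter≡∣p∣ {n} P? D P⇔ = trans
  (cong length (filter-≐ P? (_∈? D) ((λ {v} → Equivalence.to (P⇔ v)) , (λ {v} → Equivalence.from (P⇔ v))) (allFin n)))
  (sym (∣p∣≡length-filter-∈ D))

x∈p─q⇒x∉q : ∀ {x : Fin n} {p q : Subset n} → x ∈ p ─ q → x ∉ q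
x∈p─q⇒x∉q {p = inside Vec.∷ p} {outside Vec.∷ q} Vec.here ()
x∈p─q⇒x∉q {p = _ Vec.∷ p} {_ Vec.∷ q} (Vec.there x∈p─q) (Vec.there x∈q) = x∈p─q⇒x∉q x∈p─q x∈q

∈Δ⇔xor : ∀ {x : Fin n} (p q : Subset n) → x ∈ p Δ q ⇔ Bool.T (does (x ∈? p) xor does (x ∈? q))
∈Δ⇔xor {x = x} p q with x ∈? p | x ∈? q
... | yes x∈p | yes x∈q =
  mk⇔ (λ x∈pΔq → [ flip x∈p─q⇒x∉q x∈q , flip x∈p─q⇒x∉q x∈p ]′ (x∈p∪q⁻ (p ─ q) (q ─ p) x∈pΔq)) (λ ())
... | yes x∈p | no x∉q  = mk⇔ _ (λ _ → x∈p∪q⁺ (inj₁ (x∈p∧x∉q⇒x∈p─q x∈p x∉q)))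
... | no x∉p  | yes x∈q = mk⇔ _ (λ _ → x∈p∪q⁺ (inj₂ (x∈p∧x∉q⇒x∈p─q x∈q x∉p)))
... | no x∉p  | no x∉q  =
  mk⇔ (λ x∈pΔq → [ x∉p ∘ p─q⊆p p q , x∉q ∘ p─q⊆p q p ]′ (x∈p∪q⁻ (p ─ q) (q ─ p) x∈pΔq)) (λ ())

∣p∣≡∣p─q∣+∣p∩q∣ : ∀ (p q : Subset n) → ∣ p ∣ ≡ ∣ p ─ q ∣ + ∣ p ∩ q ∣
∣p∣≡∣p─q∣+∣p∩q∣ Vec.[] Vec.[] = refl
∣p∣≡∣p─q∣+∣p∩q∣ (outside Vec.∷ p) (outside Vec.∷ q) = ∣p∣≡∣p─q∣+∣p∩q∣ p q
∣p∣≡∣p─q∣+∣p∩q∣ (outside Vec.∷ p) (inside Vec.∷ q) = ∣p∣≡∣p─q∣+∣p∩q∣ p q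
∣p∣≡∣p─q∣+∣p∩q∣ (inside Vec.∷ p) (outside Vec.∷ q) = cong suc (∣p∣≡∣p─q∣+∣p∩q∣ p q)
∣p∣≡∣p─q∣+∣p∩q∣ (inside Vec.∷ p) (inside Vec.∷ q) =
  trans (cong suc (∣p∣≡∣p─q∣+∣p∩q∣ p q)) (sym (+-suc _ _))

∣pΔq∣≡∣p─q∣+∣q─p∣ : ∀ (p q : Subset n) → ∣ p Δ q ∣ ≡ ∣ p ─ q ∣ + ∣ q ─ p ∣
∣pΔq∣≡∣p─q∣+∣q─p∣ Vec.[] Vec.[] = refl
∣pΔq∣≡∣p─q∣+∣q─p∣ (outside Vec.∷ p) (outside Vec.∷ q) = ∣pΔq∣≡∣p─q∣+∣q─p∣ p q
∣pΔq∣≡∣p─q∣+∣q─p∣ (outside Vec.∷ p) (inside Vec.∷ q) =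
  trans (cong suc (∣pΔq∣≡∣p─q∣+∣q─p∣ p q)) (sym (+-suc _ _))
∣pΔq∣≡∣p─q∣+∣q─p∣ (inside Vec.∷ p) (outside Vec.∷ q) = cong suc (∣pΔq∣≡∣p─q∣+∣q─p∣ p q)
∣pΔq∣≡∣p─q∣+∣q─p∣ (inside Vec.∷ p) (inside Vec.∷ q) = ∣pΔq∣≡∣p─q∣+∣q─p∣ p q

∣p∣≡∣q∣⇒∣p─q∣≡∣q─p∣ : ∀ (p q : Subset n) → ∣ p ∣ ≡ ∣ q ∣ → ∣ p ─ q ∣ ≡ ∣ q ─ p ∣
∣p∣≡∣q∣⇒∣p─q∣≡∣q─p∣ p q ∣p∣≡∣q∣ = +-cancelʳ-≡ ∣ p ∩ q ∣ _ _ (begin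
  ∣ p ─ q ∣ + ∣ p ∩ q ∣ ≡⟨ ∣p∣≡∣p─q∣+∣p∩q∣ p q ⟨
  ∣ p ∣                 ≡⟨ ∣p∣≡∣q∣ ⟩
  ∣ q ∣                 ≡⟨ ∣p∣≡∣p─q∣+∣p∩q∣ q p ⟩
  ∣ q ─ p ∣ + ∣ q ∩ p ∣ ≡⟨ cong (λ c → ∣ q ─ p ∣ + ∣ c ∣) (∩-comm q p) ⟩
  ∣ q ─ p ∣ + ∣ p ∩ q ∣ ∎)
  where open ≡-Reasoning

outDegree inDegree : List (Edge n) → Fin n → ℕ
outDegree E v = length (filter (λ e → proj₁ e ≟ᶠ v) E)
inDegree  E v = length (filter (λ e → proj₂ e ≟ᶠ v) E)

degree-++ : ∀ (E F : List (Edge n)) v → degree (E ++ F) v ≡ degree E v + degree F v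
degree-++ E F v = begin
  degree (E ++ F) v
    ≡⟨ cong₂ _+_ (trans (cong length (filter-++ _ E F)) (length-++ (filter _ E)))
                 (trans (cong length (filter-++ _ E F)) (length-++ (filter _ E))) ⟩
  (outDegree E v + outDegree F v) + (inDegree E v + inDegree F v)
    ≡⟨ interchange +-commutativeSemigroup (outDegree E v) (outDegree F v) (inDegree E v) (inDegree F v) ⟩
  degree E v + degree F v ∎
  where open ≡-Reasoning

degree-∷ : ∀ e (E : List (Edge n)) v → degree E v ≤ degree (e ∷ E) v
degree-∷ e E v = +-mono-≤ (length-filter-∷ _ e E) (length-filter-∷ _ e E)

degree-∷-source : ∀ a b (E : List (Edge n)) → suc (degree E a) ≤ degree ((a , b) ∷ E) a
degree-∷-source a b E with a ≟ᶠ a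
... | yes _   = s≤s (+-mono-≤ ≤-refl (length-filter-∷ _ (a , b) E))
... | no a≢a  = ⊥-elim (a≢a refl)

Adj : List (Edge n) → Fin n → Fin n → Set
Adj E v w = (v , w) ∈ₗ E ⊎ (w , v) ∈ₗ E

Adj-sym : ∀ {E : List (Edge n)} {v w} → Adj E v w → Adj E w v
Adj-sym (inj₁ vw∈E) = inj₂ vw∈E
Adj-sym (inj₂ wv∈E) = inj₁ wv∈E

Adj⇒1≤degree : ∀ {E : List (Edge n)} {v w} → Adj E v w → 1 ≤ degree E v
Adj⇒1≤degree {v = v} (inj₁ vw∈E) = ≤-trans (1≤length-filter (λ e → proj₁ e ≟ᶠ v) vw∈E refl) (m≤m+n _ _)
Adj⇒1≤degree {v = v} (inj₂ wv∈E) = ≤-trans (1≤length-filter (λ e → proj₂ e ≟ᶠ v) wv∈E refl) (m≤n+m _ _)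

degree≡0⊎Adj : ∀ (E : List (Edge n)) v → degree E v ≡ 0 ⊎ ∃ (Adj E v)
degree≡0⊎Adj [] v = inj₁ refl
degree≡0⊎Adj ((a , b) ∷ E) v with a ≟ᶠ v | b ≟ᶠ v
... | yes refl | _        = inj₂ (b , inj₁ (here refl))
... | no _     | yes refl = inj₂ (a , inj₂ (here refl))
... | no _     | no _ with degree≡0⊎Adj E v
...   | inj₁ degree≡0           = inj₁ degree≡0
...   | inj₂ (w , inj₁ vw∈E)   = inj₂ (w , inj₁ (there vw∈E))
...   | inj₂ (w , inj₂ wv∈E)   = inj₂ (w , inj₂ (there wv∈E))

neighbour? : ∀ (E : List (Edge n)) v → Dec (∃ (Adj E v))
neighbour? [] v = no λ { (_ , inj₁ ()) ; (_ , inj₂ ()) }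
neighbour? ((a , b) ∷ E) v with a ≟ᶠ v | b ≟ᶠ v
... | yes refl | _        = yes (b , inj₁ (here refl))
... | no _     | yes refl = yes (a , inj₂ (here refl))
... | no a≢v   | no b≢v   = Dec.map′ extend restrict (neighbour? E v)
  where
  extend : ∃ (Adj E v) → ∃ (Adj ((a , b) ∷ E) v)
  extend (w , inj₁ vw∈E) = w , inj₁ (there vw∈E)
  extend (w , inj₂ wv∈E) = w , inj₂ (there wv∈E)
  restrict : ∃ (Adj ((a , b) ∷ E) v) → ∃ (Adj E v)
  restrict (w , inj₁ (here refl))  = ⊥-elim (a≢v refl)
  restrict (w , inj₁ (there vw∈E)) = w , inj₁ vw∈E
  restrict (w , inj₂ (here refl))  = ⊥-elim (b≢v refl)
  restrict (w , inj₂ (there wv∈E)) = w , inj₂ wv∈E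

Reach-trans : ∀ {E : List (Edge n)} {u v w} → Reach E u v → Reach E v w → Reach E u w
Reach-trans r here      = r
Reach-trans r (fwd s e) = fwd (Reach-trans r s) e
Reach-trans r (bwd s e) = bwd (Reach-trans r s) e

Reach-sym : ∀ {E : List (Edge n)} {u v} → Reach E u v → Reach E v u
Reach-sym here      = here
Reach-sym (fwd r e) = Reach-trans (bwd here e) (Reach-sym r)
Reach-sym (bwd r e) = Reach-trans (fwd here e) (Reach-sym r)

IsComponent-unique : ∀ {E : List (Edge n)} {C D x} → IsComponent E C → IsComponent E D → x ∈ C → x ∈ D → C ≡ D
IsComponent-unique {x = x} (_ , C⇔) (_ , D⇔) x∈C x∈D =
  ⊆-antisym (transfer C⇔ D⇔ x∈C x∈D) (transfer D⇔ C⇔ x∈D x∈C)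
  where
  open Equivalence
  transfer : ∀ {C D c d} → (∀ w → w ∈ C ⇔ Reach _ c w) → (∀ w → w ∈ D ⇔ Reach _ d w) →
             x ∈ C → x ∈ D → C ⊆ D
  transfer C⇔ D⇔ x∈C x∈D {w} w∈C =
    from (D⇔ w) (Reach-trans (to (D⇔ x) x∈D) (Reach-trans (Reach-sym (to (C⇔ x) x∈C)) (to (C⇔ w) w∈C)))

-- Matchings

IsMatching : List (Edge n) → Set
IsMatching M = ∀ v → degree M v ≤ 1

IsMatching-∷ : ∀ {e} {M : List (Edge n)} → IsMatching (e ∷ M) → IsMatching M
IsMatching-∷ {e = e} {M} isMatching v = ≤-trans (degree-∷ e M v) (isMatching v)

module Matching {M : List (Edge n)} (isMatching : IsMatching M) where

  private
    1+1≰degree : ∀ {v} → 1 ≤ outDegree M v → 1 ≤ inDegree M v → ⊥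
    1+1≰degree {v} 1≤out 1≤in with ≤-trans (+-mono-≤ 1≤out 1≤in) (isMatching v)
    ... | s≤s ()
    2≰outDegree : ∀ {v} → 2 ≤ outDegree M v → ⊥
    2≰outDegree {v} 2≤out with ≤-trans (≤-trans 2≤out (m≤m+n _ _)) (isMatching v)
    ... | s≤s ()
    2≰inDegree : ∀ {v} → 2 ≤ inDegree M v → ⊥
    2≰inDegree {v} 2≤in with ≤-trans (≤-trans 2≤in (m≤n+m _ _)) (isMatching v)
    ... | s≤s ()
    1≤out : ∀ {v w} → (v , w) ∈ₗ M → 1 ≤ outDegree M v
    1≤out {v} vw∈M = 1≤length-filter (λ e → proj₁ e ≟ᶠ v) vw∈M refl
    1≤in : ∀ {v w} → (w , v) ∈ₗ M → 1 ≤ inDegree M v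
    1≤in {v} wv∈M = 1≤length-filter (λ e → proj₂ e ≟ᶠ v) wv∈M refl

  Adj-unique : ∀ {v w w′} → Adj M v w → Adj M v w′ → w ≡ w′
  Adj-unique {v} {w} {w′} (inj₁ vw∈M) (inj₁ vw′∈M) with w ≟ᶠ w′
  ... | yes w≡w′ = w≡w′
  ... | no w≢w′  = ⊥-elim (2≰outDegree
                     (2≤length-filter (λ e → proj₁ e ≟ᶠ v) vw∈M vw′∈M (w≢w′ ∘ cong proj₂) refl refl))
  Adj-unique (inj₁ vw∈M) (inj₂ w′v∈M) = ⊥-elim (1+1≰degree (1≤out vw∈M) (1≤in w′v∈M))
  Adj-unique (inj₂ wv∈M) (inj₁ vw′∈M) = ⊥-elim (1+1≰degree (1≤out vw′∈M) (1≤in wv∈M))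
  Adj-unique {v} {w} {w′} (inj₂ wv∈M) (inj₂ w′v∈M) with w ≟ᶠ w′
  ... | yes w≡w′ = w≡w′
  ... | no w≢w′  = ⊥-elim (2≰inDegree
                     (2≤length-filter (λ e → proj₂ e ≟ᶠ v) wv∈M w′v∈M (w≢w′ ∘ cong proj₁) refl refl))

  ¬Adj-refl : ∀ {v} → ¬ Adj M v v
  ¬Adj-refl (inj₁ vv∈M) = 1+1≰degree (1≤out vv∈M) (1≤in vv∈M)
  ¬Adj-refl (inj₂ vv∈M) = 1+1≰degree (1≤out vv∈M) (1≤in vv∈M)

  Adj⇒degree≡1 : ∀ {v w} → Adj M v w → degree M v ≡ 1
  Adj⇒degree≡1 {v} vw = ≤-antisym (isMatching v) (Adj⇒1≤degree vw)

  ¬Adj⇒degree≡0 : ∀ {v} → ¬ ∃ (Adj M v) → degree M v ≡ 0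
  ¬Adj⇒degree≡0 {v} ¬adj with degree≡0⊎Adj M v
  ... | inj₁ degree≡0 = degree≡0
  ... | inj₂ vw       = ⊥-elim (¬adj vw)

norm-cases : ∀ (e : Edge n) → norm e ≡ e ⊎ norm e ≡ swap e
norm-cases (a , b) with toℕ b ≤? toℕ a
... | yes _ = inj₁ refl
... | no _  = inj₂ refl

norm-swap : ∀ (e : Edge n) → norm (swap e) ≡ norm e
norm-swap (a , b) with toℕ a ≤? toℕ b | toℕ b ≤? toℕ a
... | yes a≤b | yes b≤a with toℕ-injective (≤-antisym a≤b b≤a)
...   | refl = refl
norm-swap (a , b) | yes _   | no _    = refl
norm-swap (a , b) | no _    | yes _   = refl
norm-swap (a , b) | no a≰b  | no b≰a  = ⊥-elim (b≰a (≰⇒≥ a≰b))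

norm-injective : ∀ (e e′ : Edge n) → norm e ≡ norm e′ → e ≡ e′ ⊎ e ≡ swap e′
norm-injective e e′ eq with norm-cases e | norm-cases e′
... | inj₁ p | inj₁ q = inj₁ (trans (sym p) (trans eq q))
... | inj₁ p | inj₂ q = inj₂ (trans (sym p) (trans eq q))
... | inj₂ p | inj₁ q = inj₂ (cong swap (trans (sym p) (trans eq q)))
... | inj₂ p | inj₂ q = inj₁ (cong swap (trans (sym p) (trans eq q)))

Unique-norm-filter : ∀ {P : Pred (Edge n) p} (P? : Decidable P) (M : List (Edge n)) →
  IsMatching M → Unique (map norm (filter P? M))
Unique-norm-filter P? [] _ = []
Unique-norm-filter P? ((a , b) ∷ M) isMatching with P? (a , b)
... | no _  = Unique-norm-filter P? M (IsMatching-∷ {e = a , b} {M} isMatching)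
... | yes _ = Unique-∷ ab∉ (Unique-norm-filter P? M (IsMatching-∷ {e = a , b} {M} isMatching))
  where
  a-saturated : ∀ {w} → ¬ Adj M a w
  a-saturated aw with ≤-trans (≤-trans (s≤s (Adj⇒1≤degree aw)) (degree-∷-source a b M)) (isMatching a)
  ... | s≤s ()
  ab∉ : norm (a , b) ∉ₗ map norm (filter P? M)
  ab∉ ab∈ with ∈-map⁻ norm ab∈
  ... | e , e∈ , eq with norm-injective (a , b) e eq | proj₁ (∈-filter⁻ P? e∈)
  ...   | inj₁ refl | ab∈M = a-saturated (inj₁ ab∈M)
  ...   | inj₂ refl | ba∈M = a-saturated (inj₂ ba∈M)

∈-consecutive⁻ : ∀ {p q : Fin n} xs → (p , q) ∈ₗ consecutive xs → p ∈ₗ xs × q ∈ₗ xs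
∈-consecutive⁻ (a ∷ b ∷ rest) (here refl) = here refl , there (here refl)
∈-consecutive⁻ (a ∷ b ∷ rest) (there pq∈) with ∈-consecutive⁻ (b ∷ rest) pq∈
... | p∈ , q∈ = there p∈ , there q∈

Unique-norm-consecutive : ∀ (xs : List (Fin n)) → Unique xs → Unique (map norm (consecutive xs))
Unique-norm-consecutive []            _ = []
Unique-norm-consecutive (a ∷ [])      _ = []
Unique-norm-consecutive (a ∷ b ∷ rest) u@(_ ∷ u′) = Unique-∷ ab∉ (Unique-norm-consecutive (b ∷ rest) u′)
  where
  ab∉ : norm (a , b) ∉ₗ map norm (consecutive (b ∷ rest))
  ab∉ ab∈ with ∈-map⁻ norm ab∈
  ... | (p , q) , pq∈ , eq with ∈-consecutive⁻ (b ∷ rest) pq∈ | norm-injective _ _ eq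
  ...   | a∈ , _ | inj₁ refl = Unique.Unique[x∷xs]⇒x∉xs u a∈
  ...   | _ , a∈ | inj₂ refl = Unique.Unique[x∷xs]⇒x∉xs u a∈

consecutive-head : ∀ {a b p q : Fin n} rest → Unique (a ∷ b ∷ rest) →
  (p , q) ∈ₗ consecutive (a ∷ b ∷ rest) → p ≡ a ⊎ q ≡ a → p ≡ a × q ≡ b
consecutive-head rest u (here refl) _ = refl , refl
consecutive-head {b = b} rest u (there pq∈) (inj₁ refl) =
  ⊥-elim (Unique.Unique[x∷xs]⇒x∉xs u (proj₁ (∈-consecutive⁻ (b ∷ rest) pq∈)))
consecutive-head {b = b} rest u (there pq∈) (inj₂ refl) =
  ⊥-elim (Unique.Unique[x∷xs]⇒x∉xs u (proj₂ (∈-consecutive⁻ (b ∷ rest) pq∈)))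

toSubset : List (Fin n) → Subset n
toSubset []       = Subset.⊥
toSubset (x ∷ xs) = ⁅ x ⁆ ∪ toSubset xs

∈-toSubset⁺ : ∀ {x : Fin n} {xs} → x ∈ₗ xs → x ∈ toSubset xs
∈-toSubset⁺ {xs = y ∷ xs} (here refl) = x∈p∪q⁺ (inj₁ (x∈⁅x⁆ y))
∈-toSubset⁺ {xs = y ∷ xs} (there x∈) = x∈p∪q⁺ (inj₂ (∈-toSubset⁺ x∈))

∈-toSubset⁻ : ∀ {x : Fin n} xs → x ∈ toSubset xs → x ∈ₗ xs
∈-toSubset⁻ []       x∈ = ⊥-elim (∉⊥ x∈)
∈-toSubset⁻ (y ∷ xs) x∈ with x∈p∪q⁻ ⁅ y ⁆ (toSubset xs) x∈
... | inj₁ x∈⁅y⁆ = here (x∈⁅y⁆⇒x≡y y x∈⁅y⁆)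
... | inj₂ x∈xs  = there (∈-toSubset⁻ xs x∈xs)

-- Unions of two matchings

data Side : Set where
  left right : Side

opposite : Side → Side
opposite left  = right
opposite right = left

opposite-involutive : ∀ s → opposite (opposite s) ≡ s
opposite-involutive left  = refl
opposite-involutive right = refl

opposite-≢ : ∀ s → s ≢ opposite s
opposite-≢ left  ()
opposite-≢ right ()

Side-cases : ∀ t s → t ≡ s ⊎ t ≡ opposite s
Side-cases left  left  = inj₁ refl
Side-cases left  right = inj₂ refl
Side-cases right left  = inj₂ refl
Side-cases right right = inj₁ refl

module MatchingUnion {n} (A B : List (Edge n)) (isMatchingA : IsMatching A) (isMatchingB : IsMatching B) where

  E : List (Edge n)
  E = A ++ B

  edges : Side → List (Edge n)
  edges left  = A
  edges right = B

  edges-isMatching : ∀ s → IsMatching (edges s)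
  edges-isMatching left  = isMatchingA
  edges-isMatching right = isMatchingB

  AdjOn : Side → Fin n → Fin n → Set
  AdjOn s = Adj (edges s)

  AdjOn-unique : ∀ s {v w w′} → AdjOn s v w → AdjOn s v w′ → w ≡ w′
  AdjOn-unique s = Matching.Adj-unique (edges-isMatching s)

  ¬AdjOn-refl : ∀ s {v} → ¬ AdjOn s v v
  ¬AdjOn-refl s = Matching.¬Adj-refl (edges-isMatching s)

  edges⊆E : ∀ s {e} → e ∈ₗ edges s → e ∈ₗ E
  edges⊆E left  e∈A = ∈-++⁺ˡ e∈A
  edges⊆E right e∈B = ∈-++⁺ʳ A e∈B

  E⊆edges : ∀ {e} → e ∈ₗ E → ∃ λ s → e ∈ₗ edges s
  E⊆edges e∈E with ∈-++⁻ A e∈E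
  ... | inj₁ e∈A = left , e∈A
  ... | inj₂ e∈B = right , e∈B

  Reach-AdjOn : ∀ s {u x y} → Reach E u x → AdjOn s x y → Reach E u y
  Reach-AdjOn s r (inj₁ xy∈) = fwd r (edges⊆E s xy∈)
  Reach-AdjOn s r (inj₂ yx∈) = bwd r (edges⊆E s yx∈)

  Leaf : Fin n → Set
  Leaf v = degree E v ≡ 1

  Leaf? : ∀ v → Dec (Leaf v)
  Leaf? v = degree E v ≟ℕ 1

  degree≡ : ∀ v → degree E v ≡ degree A v + degree B v
  degree≡ = degree-++ A B

  leaf-oneSided : ∀ t {v y} → AdjOn t v y → ¬ ∃ (AdjOn (opposite t) v) → Leaf v
  leaf-oneSided left  {v} vy ¬adj
    rewrite degree≡ v | Matching.Adj⇒degree≡1 isMatchingA vy | Matching.¬Adj⇒degree≡0 isMatchingB ¬adj = refl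
  leaf-oneSided right {v} vy ¬adj
    rewrite degree≡ v | Matching.Adj⇒degree≡1 isMatchingB vy | Matching.¬Adj⇒degree≡0 isMatchingA ¬adj = refl

  ¬leaf-twoSided : ∀ {v y y′} → AdjOn left v y → AdjOn right v y′ → ¬ Leaf v
  ¬leaf-twoSided {v} vy vy′ leaf
    rewrite degree≡ v | Matching.Adj⇒degree≡1 isMatchingA vy | Matching.Adj⇒degree≡1 isMatchingB vy′ with leaf
  ... | ()

  startSide : Fin n → Side
  startSide u = if does (neighbour? A u) then left else right

  leaf-startSide : ∀ {u} → Leaf u → ∃ (AdjOn (startSide u) u) × ¬ ∃ (AdjOn (opposite (startSide u)) u)
  leaf-startSide {u} leaf with neighbour? A u
  ... | yes (w , uw) = (w , uw) , λ (_ , uy) → ¬leaf-twoSided uw uy leaf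
  ... | no ¬adjA with neighbour? B u
  ...   | yes uw   = uw , ¬adjA
  ...   | no ¬adjB = ⊥-elim (1+n≢0 (trans (sym leaf) (trans (degree≡ u)
                       (cong₂ _+_ (Matching.¬Adj⇒degree≡0 isMatchingA ¬adjA) (Matching.¬Adj⇒degree≡0 isMatchingB ¬adjB)))))

  bothSides : ∀ s {x y y′} → AdjOn s x y → AdjOn (opposite s) x y′ → ∃ (AdjOn left x) × ∃ (AdjOn right x)
  bothSides left  xy xy′ = (_ , xy) , (_ , xy′)
  bothSides right xy xy′ = (_ , xy′) , (_ , xy)

  doubleEdge : ∀ s {x y} → AdjOn left x y × AdjOn right x y → AdjOn s x y × AdjOn (opposite s) x y
  doubleEdge left  (l , r) = l , r
  doubleEdge right (l , r) = r , l

  -- The walk from u to v is stored backwards as v ∷ older and continues from v along side s.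
  -- Once v has no neighbour on side s, the fields say that v ∷ older lists the component of u
  -- as a path.
  record AlternatingWalk (u : Fin n) (s : Side) (v : Fin n) (older : List (Fin n)) : Set where
    field
      distinct        : Unique (v ∷ older)
      older-closed    : ∀ {x t y} → x ∈ₗ older → AdjOn t x y → y ∈ₗ older ⊎ (y ≡ v × t ≡ opposite s)
      arrival-older   : ∀ {y} → AdjOn (opposite s) v y → y ∈ₗ older
      edges-on-walk   : ∀ {x t y} → x ∈ₗ (v ∷ older) → AdjOn t x y →
                          norm (x , y) ∈ₗ map norm (consecutive (v ∷ older)) ⊎ (x ≡ v × t ≡ s)
      steps-are-edges : ∀ {p q} → (p , q) ∈ₗ consecutive (v ∷ older) → ∃ λ t → AdjOn t p q
      older-simple    : ∀ {x y} → x ∈ₗ older → ¬ (AdjOn left x y × AdjOn right x y)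
      reachable       : ∀ {x} → x ∈ₗ (v ∷ older) → Reach E u x
      older-interior  : ∀ {x} → x ∈ₗ older → x ≢ u → ∃ (AdjOn left x) × ∃ (AdjOn right x)
      arrival         : v ≢ u → ∃ (AdjOn (opposite s) v)
      origin          : (older ≡ [] × v ≡ u × s ≡ startSide u) ⊎ u ∈ₗ older

  start : ∀ {u} → Leaf u → AlternatingWalk u (startSide u) u []
  start {u} leaf = record
    { distinct        = Unique-∷ (λ ()) []
    ; older-closed    = λ ()
    ; arrival-older   = λ {y} uy → ⊥-elim (proj₂ (leaf-startSide leaf) (y , uy))
    ; edges-on-walk   = edges-on-walk
    ; steps-are-edges = λ ()
    ; older-simple    = λ ()
    ; reachable       = λ { (here refl) → here }
    ; older-interior  = λ ()
    ; arrival         = λ u≢u → ⊥-elim (u≢u refl)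
    ; origin          = inj₁ (refl , refl , refl)
    }
    where
    edges-on-walk : ∀ {x t y} → x ∈ₗ (u ∷ []) → AdjOn t x y →
                      norm (x , y) ∈ₗ map norm (consecutive (u ∷ [])) ⊎ (x ≡ u × t ≡ startSide u)
    edges-on-walk {t = t} (here refl) uy with Side-cases t (startSide u)
    ... | inj₁ t≡ = inj₂ (refl , t≡)
    ... | inj₂ refl = ⊥-elim (proj₂ (leaf-startSide leaf) (_ , uy))

  module Extend {u s v older w} (W : AlternatingWalk u s v older) (vw : AdjOn s v w) where

    open AlternatingWalk W

    w∉walk : w ∉ₗ v ∷ older
    w∉walk (here refl) = ¬AdjOn-refl s vw
    w∉walk (there w∈) with older-closed w∈ (Adj-sym vw)
    ... | inj₁ v∈older  = Unique.Unique[x∷xs]⇒x∉xs distinct v∈older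
    ... | inj₂ (_ , s≡) = opposite-≢ s s≡

    older-closed′ : ∀ {x t y} → x ∈ₗ v ∷ older → AdjOn t x y →
                    y ∈ₗ v ∷ older ⊎ (y ≡ w × t ≡ opposite (opposite s))
    older-closed′ {t = t} (here refl) xy with Side-cases t s
    ... | inj₁ refl = inj₂ (AdjOn-unique t xy vw , sym (opposite-involutive t))
    ... | inj₂ refl = inj₁ (there (arrival-older xy))
    older-closed′ (there x∈) xy with older-closed x∈ xy
    ... | inj₁ y∈older    = inj₁ (there y∈older)
    ... | inj₂ (refl , _) = inj₁ (here refl)

    arrival-older′ : ∀ {y} → AdjOn (opposite (opposite s)) w y → y ∈ₗ v ∷ older
    arrival-older′ {y} wy = here (AdjOn-unique s (subst (λ t → AdjOn t w y) (opposite-involutive s) wy) (Adj-sym vw))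

    edges-on-walk′ : ∀ {x t y} → x ∈ₗ w ∷ v ∷ older → AdjOn t x y →
                       norm (x , y) ∈ₗ map norm (consecutive (w ∷ v ∷ older)) ⊎ (x ≡ w × t ≡ opposite s)
    edges-on-walk′ {t = t} (here refl) xy with Side-cases t s
    ... | inj₁ refl = inj₁ (here (cong (λ z → norm (w , z)) (AdjOn-unique t xy (Adj-sym vw))))
    ... | inj₂ t≡   = inj₂ (refl , t≡)
    edges-on-walk′ (there x∈) xy with edges-on-walk x∈ xy
    ... | inj₁ xy∈           = inj₁ (there xy∈)
    ... | inj₂ (refl , refl) = inj₁ (here (trans (cong (λ z → norm (v , z)) (AdjOn-unique s xy vw)) (norm-swap (w , v))))

    steps-are-edges′ : ∀ {p q} → (p , q) ∈ₗ consecutive (w ∷ v ∷ older) → ∃ λ t → AdjOn t p q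
    steps-are-edges′ (here refl) = s , Adj-sym vw
    steps-are-edges′ (there pq∈) = steps-are-edges pq∈

    older-simple′ : ∀ {x y} → x ∈ₗ v ∷ older → ¬ (AdjOn left x y × AdjOn right x y)
    older-simple′ (here refl) double with doubleEdge s double
    ... | vy , vy′ = w∉walk (subst (_∈ₗ v ∷ older) (AdjOn-unique s vy vw) (there (arrival-older vy′)))
    older-simple′ (there x∈) = older-simple x∈

    reachable′ : ∀ {x} → x ∈ₗ w ∷ v ∷ older → Reach E u x
    reachable′ (here refl) = Reach-AdjOn s (reachable (here refl)) vw
    reachable′ (there x∈)  = reachable x∈

    older-interior′ : ∀ {x} → x ∈ₗ v ∷ older → x ≢ u → ∃ (AdjOn left x) × ∃ (AdjOn right x)
    older-interior′ (here refl) v≢u = bothSides s vw (proj₂ (arrival v≢u))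
    older-interior′ (there x∈)  x≢u = older-interior x∈ x≢u

    arrival′ : w ≢ u → ∃ (AdjOn (opposite (opposite s)) w)
    arrival′ _ = v , subst (λ t → AdjOn t w v) (sym (opposite-involutive s)) (Adj-sym vw)

    origin′ : (v ∷ older ≡ [] × w ≡ u × opposite s ≡ startSide u) ⊎ u ∈ₗ v ∷ older
    origin′ with origin
    ... | inj₁ (_ , refl , _) = inj₂ (here refl)
    ... | inj₂ u∈older        = inj₂ (there u∈older)

  step : ∀ {u s v older w} → AlternatingWalk u s v older → AdjOn s v w → AlternatingWalk u (opposite s) w (v ∷ older)
  step W vw = record
    { distinct        = Unique-∷ w∉walk (AlternatingWalk.distinct W)
    ; older-closed    = older-closed′
    ; arrival-older   = arrival-older′
    ; edges-on-walk   = edges-on-walk′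
    ; steps-are-edges = steps-are-edges′
    ; older-simple    = older-simple′
    ; reachable       = reachable′
    ; older-interior  = older-interior′
    ; arrival         = arrival′
    ; origin          = origin′
    }
    where open Extend W vw

  State : Set
  State = Side × Fin n × List (Fin n)

  walk : ℕ → State → State
  walk zero state = state
  walk (suc fuel) (s , v , older) with neighbour? (edges s) v
  ... | yes (w , _) = walk fuel (opposite s , w , v ∷ older)
  ... | no _        = s , v , older

  Maximal : Fin n → State → Set
  Maximal u (s , v , older) = AlternatingWalk u s v older × ¬ ∃ (AdjOn s v)

  walk-maximal : ∀ {u} fuel s v older → AlternatingWalk u s v older → n ≤ length older + fuel →
    Maximal u (walk fuel (s , v , older))
  walk-maximal zero s v older W n≤ =
    ⊥-elim (<-irrefl refl (≤-trans (s≤s (≤-trans n≤ (≤-reflexive (+-identityʳ _))))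
                                   (Unique⇒length≤ (AlternatingWalk.distinct W))))
  walk-maximal (suc fuel) s v older W n≤ with neighbour? (edges s) v
  ... | yes (w , vw) = walk-maximal fuel (opposite s) w (v ∷ older) (step W vw) (≤-trans n≤ (≤-reflexive (+-suc _ fuel)))
  ... | no ¬adj      = W , ¬adj

  -- n + 1 steps suffice because a walk never revisits a vertex.
  finalState : Fin n → State
  finalState u = walk (suc n) (startSide u , u , [])

  endSide : Fin n → Side
  endSide u = proj₁ (finalState u)

  otherEnd : Fin n → Fin n
  otherEnd u = proj₁ (proj₂ (finalState u))

  pathFrom : Fin n → List (Fin n)
  pathFrom u = otherEnd u ∷ proj₂ (proj₂ (finalState u))

  componentOf : Fin n → Subset n
  componentOf u = toSubset (pathFrom u)

  module FromLeaf {u} (leaf : Leaf u) where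

    private
      older : List (Fin n)
      older = proj₂ (proj₂ (finalState u))
      maximal : Maximal u (finalState u)
      maximal = walk-maximal (suc n) (startSide u) u [] (start leaf) (n≤1+n n)
      W : AlternatingWalk u (endSide u) (otherEnd u) older
      W = proj₁ maximal
      stuck : ¬ ∃ (AdjOn (endSide u) (otherEnd u))
      stuck = proj₂ maximal
      open AlternatingWalk W

    u∈older : u ∈ₗ older
    u∈older with origin
    ... | inj₂ u∈ = u∈
    ... | inj₁ (_ , v≡u , s≡) =
      ⊥-elim (stuck (subst₂ (λ t x → ∃ (AdjOn t x)) (sym s≡) (sym v≡u) (proj₁ (leaf-startSide leaf))))

    u∈pathFrom : u ∈ₗ pathFrom u
    u∈pathFrom = there u∈older

    u∈componentOf : u ∈ componentOf u
    u∈componentOf = ∈-toSubset⁺ u∈pathFrom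

    otherEnd-reachable : Reach E u (otherEnd u)
    otherEnd-reachable = reachable (here refl)

    otherEnd≢u : otherEnd u ≢ u
    otherEnd≢u eq = Unique.Unique[x∷xs]⇒x∉xs distinct (subst (_∈ₗ older) (sym eq) u∈older)

    otherEnd-leaf : Leaf (otherEnd u)
    otherEnd-leaf = leaf-oneSided (opposite (endSide u)) (proj₂ (arrival otherEnd≢u))
      (λ (y , vy) → stuck (y , subst (λ t → AdjOn t (otherEnd u) y) (opposite-involutive (endSide u)) vy))

    pathFrom-closed : ∀ {x t y} → x ∈ₗ pathFrom u → AdjOn t x y → y ∈ₗ pathFrom u
    pathFrom-closed x∈ xy with edges-on-walk x∈ xy
    ... | inj₂ (refl , refl) = ⊥-elim (stuck (_ , xy))
    ... | inj₁ xy∈ with ∈-map⁻ norm xy∈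
    ...   | (p , q) , pq∈ , eq with ∈-consecutive⁻ (pathFrom u) pq∈ | norm-injective _ _ eq
    ...     | _ , q∈ | inj₁ refl = q∈
    ...     | p∈ , _ | inj₂ refl = p∈

    Reach⇒∈pathFrom : ∀ {x} → Reach E u x → x ∈ₗ pathFrom u
    Reach⇒∈pathFrom here = u∈pathFrom
    Reach⇒∈pathFrom (fwd r e) = pathFrom-closed (Reach⇒∈pathFrom r) (inj₁ (proj₂ (E⊆edges e)))
    Reach⇒∈pathFrom (bwd r e) = pathFrom-closed (Reach⇒∈pathFrom r) (inj₂ (proj₂ (E⊆edges e)))

    isComponent : IsComponent E (componentOf u)
    isComponent = u , λ w → mk⇔ (reachable ∘ ∈-toSubset⁻ (pathFrom u)) (∈-toSubset⁺ ∘ Reach⇒∈pathFrom)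

    pathFrom-simple : ∀ {x y} → x ∈ₗ pathFrom u → ¬ (AdjOn left x y × AdjOn right x y)
    pathFrom-simple (here refl) double = stuck (_ , proj₁ (doubleEdge (endSide u) double))
    pathFrom-simple (there x∈)  double = older-simple x∈ double

    private
      inC? : (e : Edge n) → Dec (proj₁ e ∈ componentOf u)
      inC? e = proj₁ e ∈? componentOf u

    Unique-norm-edgesIn : Unique (map norm (edgesIn E (componentOf u)))
    Unique-norm-edgesIn rewrite filter-++ inC? A B | map-++ norm (filter inC? A) (filter inC? B) =
      Unique.++⁺ (Unique-norm-filter inC? A isMatchingA) (Unique-norm-filter inC? B isMatchingB) disjoint
      where
      disjoint : ∀ {z} → ¬ (z ∈ₗ map norm (filter inC? A) × z ∈ₗ map norm (filter inC? B))
      disjoint (z∈A , z∈B) with ∈-map⁻ norm z∈A | ∈-map⁻ norm z∈B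
      ... | (a , b) , ab∈ , refl | e , e∈ , eq
            with ∈-filter⁻ inC? ab∈ | proj₁ (∈-filter⁻ inC? e∈) | norm-injective (a , b) e eq
      ...   | ab∈A , a∈C | ab∈B | inj₁ refl = pathFrom-simple (∈-toSubset⁻ (pathFrom u) a∈C) (inj₁ ab∈A , inj₁ ab∈B)
      ...   | ab∈A , a∈C | ba∈B | inj₂ refl = pathFrom-simple (∈-toSubset⁻ (pathFrom u) a∈C) (inj₁ ab∈A , inj₂ ba∈B)

    edgesIn⊆consecutive : ∀ {z} → z ∈ₗ map norm (edgesIn E (componentOf u)) → z ∈ₗ map norm (consecutive (pathFrom u))
    edgesIn⊆consecutive z∈ with ∈-map⁻ norm z∈
    ... | (a , b) , ab∈ , refl with ∈-filter⁻ inC? ab∈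
    ...   | ab∈E , a∈C with E⊆edges ab∈E
    ...     | t , ab∈t with edges-on-walk (∈-toSubset⁻ (pathFrom u) a∈C) (inj₁ ab∈t)
    ...       | inj₁ ab∈′          = ab∈′
    ...       | inj₂ (refl , refl) = ⊥-elim (stuck (_ , inj₁ ab∈t))

    consecutive⊆edgesIn : ∀ {z} → z ∈ₗ map norm (consecutive (pathFrom u)) → z ∈ₗ map norm (edgesIn E (componentOf u))
    consecutive⊆edgesIn z∈ with ∈-map⁻ norm z∈
    ... | (p , q) , pq∈ , refl with steps-are-edges pq∈ | ∈-consecutive⁻ (pathFrom u) pq∈
    ...   | t , inj₁ pq∈t | p∈ , _ = ∈-map⁺ norm (∈-filter⁺ inC? (edges⊆E t pq∈t) (∈-toSubset⁺ p∈))
    ...   | t , inj₂ qp∈t | _ , q∈ = subst (_∈ₗ map norm (edgesIn E (componentOf u))) (norm-swap (p , q))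
                                       (∈-map⁺ norm (∈-filter⁺ inC? (edges⊆E t qp∈t) (∈-toSubset⁺ q∈)))

    isPathOn : IsPathOn E (componentOf u)
    isPathOn = pathFrom u , s≤s (∈-length u∈older) , distinct ,
               (λ w → mk⇔ (∈-toSubset⁻ (pathFrom u)) ∈-toSubset⁺) ,
               Unique-sameMembers⇒↭ Unique-norm-edgesIn (Unique-norm-consecutive (pathFrom u) distinct)
                 edgesIn⊆consecutive consecutive⊆edgesIn

    isPathComponent : IsPathComponent E (componentOf u)
    isPathComponent = isComponent , isPathOn

    leaf-on-path : ∀ {x} → x ∈ₗ pathFrom u → Leaf x → x ≡ u ⊎ x ≡ otherEnd u
    leaf-on-path (here refl) _ = inj₂ refl
    leaf-on-path {x} (there x∈) leafx with x ≟ᶠ u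
    ... | yes x≡u = inj₁ x≡u
    ... | no x≢u with older-interior x∈ x≢u
    ...   | (_ , xy) , (_ , xy′) = ⊥-elim (¬leaf-twoSided xy xy′ leafx)

  otherEnd∈componentOf : ∀ u → otherEnd u ∈ componentOf u
  otherEnd∈componentOf u = ∈-toSubset⁺ {xs = pathFrom u} (here refl)

  otherEnd-involutive : ∀ {u} → Leaf u → otherEnd (otherEnd u) ≡ u
  otherEnd-involutive {u} leaf with FromLeaf.leaf-on-path leaf
         (FromLeaf.Reach⇒∈pathFrom leaf (Reach-trans (FromLeaf.otherEnd-reachable leaf) (FromLeaf.otherEnd-reachable leaf′)))
         (FromLeaf.otherEnd-leaf leaf′)
    where leaf′ = FromLeaf.otherEnd-leaf leaf
  ... | inj₁ ≡u = ≡u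
  ... | inj₂ ≡otherEnd = ⊥-elim (FromLeaf.otherEnd≢u (FromLeaf.otherEnd-leaf leaf) ≡otherEnd)

  componentOf-otherEnd : ∀ {u} → Leaf u → componentOf (otherEnd u) ≡ componentOf u
  componentOf-otherEnd {u} leaf = IsComponent-unique (FromLeaf.isComponent leaf′) (FromLeaf.isComponent leaf)
    (FromLeaf.u∈componentOf leaf′) (otherEnd∈componentOf u)
    where leaf′ = FromLeaf.otherEnd-leaf leaf

  module PathStart {C} (isComponent : IsComponent E C) {a b rest} (distinct : Unique (a ∷ b ∷ rest))
    (∈C⇔ : ∀ w → w ∈ C ⇔ w ∈ₗ a ∷ b ∷ rest)
    (edges↭ : map norm (edgesIn E C) ↭ map norm (consecutive (a ∷ b ∷ rest))) where

    private
      open Equivalence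
      inC? : (e : Edge n) → Dec (proj₁ e ∈ C)
      inC? e = proj₁ e ∈? C
      edge∈C : ∀ {t x y} → AdjOn t x y → x ∈ C → norm (x , y) ∈ₗ map norm (consecutive (a ∷ b ∷ rest))
      edge∈C {t} {x} {y} (inj₁ xy∈) x∈C = ∈-resp-↭ edges↭ (∈-map⁺ norm (∈-filter⁺ inC? (edges⊆E t xy∈) x∈C))
      edge∈C {t} {x} {y} (inj₂ yx∈) x∈C =
        subst (_∈ₗ _) (norm-swap (x , y)) (∈-resp-↭ edges↭ (∈-map⁺ norm (∈-filter⁺ inC? (edges⊆E t yx∈) y∈C)))
        where
        y∈C : y ∈ C
        y∈C = from (proj₂ isComponent y) (Reach-AdjOn t (to (proj₂ isComponent x) x∈C) (inj₂ yx∈))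

    a∈C : a ∈ C
    a∈C = from (∈C⇔ a) (here refl)

    ab-edge : ∃ λ t → AdjOn t a b
    ab-edge with ∈-map⁻ norm (∈-resp-↭ (↭-sym edges↭) (here refl))
    ... | e , e∈ , eq with E⊆edges (proj₁ (∈-filter⁻ inC? {xs = E} e∈)) | norm-injective (a , b) e eq
    ...   | t , ab∈ | inj₁ refl = t , inj₁ ab∈
    ...   | t , ba∈ | inj₂ refl = t , inj₂ ba∈

    neighbour≡b : ∀ {t y} → AdjOn t a y → y ≡ b
    neighbour≡b {t} {y} ay with ∈-map⁻ norm (edge∈C ay a∈C)
    ... | (p , q) , pq∈ , eq with norm-injective (a , y) (p , q) eq
    ...   | inj₁ refl = proj₂ (consecutive-head rest distinct pq∈ (inj₁ refl))
    ...   | inj₂ refl = ⊥-elim (¬AdjOn-refl t (subst (AdjOn t a) (proj₁ (consecutive-head rest distinct pq∈ (inj₂ refl))) ay))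

    ¬doubleEdge : ¬ (AdjOn left a b × AdjOn right a b)
    ¬doubleEdge (abₗ , abᵣ) = Unique-++⇒disjoint (map norm (filter inC? A)) unique (onSide left abₗ) (onSide right abᵣ)
      where
      unique : Unique (map norm (filter inC? A) ++ map norm (filter inC? B))
      unique = subst Unique (trans (cong (map norm) (filter-++ inC? A B)) (map-++ norm (filter inC? A) (filter inC? B)))
                 (Unique-resp-↭ (↭-sym edges↭) (Unique-norm-consecutive (a ∷ b ∷ rest) distinct))
      onSide : ∀ s → AdjOn s a b → norm (a , b) ∈ₗ map norm (filter inC? (edges s))
      onSide s (inj₁ ab∈) = ∈-map⁺ norm (∈-filter⁺ inC? ab∈ a∈C)
      onSide s (inj₂ ba∈) =
        subst (_∈ₗ map norm (filter inC? (edges s))) (sym (norm-swap (b , a))) (∈-map⁺ norm (∈-filter⁺ inC? ba∈ b∈C))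
        where
        b∈C : b ∈ C
        b∈C = from (∈C⇔ b) (there (here refl))

    ¬oppositeNeighbour : ∀ t → AdjOn t a b → ¬ ∃ (AdjOn (opposite t) a)
    ¬oppositeNeighbour left  ab (y , ay) with refl ← neighbour≡b ay = ¬doubleEdge (ab , ay)
    ¬oppositeNeighbour right ab (y , ay) with refl ← neighbour≡b ay = ¬doubleEdge (ay , ab)

    leaf : Leaf a
    leaf = leaf-oneSided (proj₁ ab-edge) (proj₂ ab-edge) (¬oppositeNeighbour (proj₁ ab-edge) (proj₂ ab-edge))

  IsPathComponent⇒leaf : ∀ {C} → IsPathComponent E C → ∃ λ a → Leaf a × a ∈ C
  IsPathComponent⇒leaf (_ , [] , () , _)
  IsPathComponent⇒leaf (_ , _ ∷ [] , s≤s () , _)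
  IsPathComponent⇒leaf (isComponent , a ∷ b ∷ rest , _ , distinct , ∈C⇔ , edges↭) =
    a , PathStart.leaf isComponent distinct ∈C⇔ edges↭ , PathStart.a∈C isComponent distinct ∈C⇔ edges↭

  -- Each path component is listed once, through its endpoint of smaller index.
  Representative : Fin n → Set
  Representative u = Leaf u × toℕ u < toℕ (otherEnd u)

  representative? : ∀ u → Dec (Representative u)
  representative? u = Leaf? u ×-dec toℕ u <? toℕ (otherEnd u)

  representatives : List (Fin n)
  representatives = filter representative? (allFin n)

  pathComponents : List (Subset n)
  pathComponents = map componentOf representatives

  ∈-representatives⁻ : ∀ {u} → u ∈ₗ representatives → Representative u
  ∈-representatives⁻ u∈ = proj₂ (∈-filter⁻ representative? {xs = allFin n} u∈)

  ∈-representatives⁺ : ∀ {u} → Representative u → u ∈ₗ representatives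
  ∈-representatives⁺ {u} rep = ∈-filter⁺ representative? (∈-allFin u) rep

  representative⇒¬representative-otherEnd : ∀ {u} → Representative u → ¬ Representative (otherEnd u)
  representative⇒¬representative-otherEnd {u} (leaf , u<) (_ , v<) =
    <-asym u< (subst (λ w → toℕ (otherEnd u) < toℕ w) (otherEnd-involutive leaf) v<)

  leaf⇒representative : ∀ {u} → Leaf u → Representative u ⊎ Representative (otherEnd u)
  leaf⇒representative {u} leaf with toℕ u <? toℕ (otherEnd u)
  ... | yes u<v = inj₁ (leaf , u<v)
  ... | no u≮v  = inj₂ (FromLeaf.otherEnd-leaf leaf , subst (λ w → toℕ (otherEnd u) < toℕ w) (sym (otherEnd-involutive leaf))
                          (≤∧≢⇒< (≮⇒≥ u≮v) (FromLeaf.otherEnd≢u leaf ∘ toℕ-injective)))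

  componentOf∈pathComponents : ∀ {u} → Leaf u → componentOf u ∈ₗ pathComponents
  componentOf∈pathComponents leaf with leaf⇒representative leaf
  ... | inj₁ rep = ∈-map⁺ componentOf (∈-representatives⁺ rep)
  ... | inj₂ rep = subst (_∈ₗ pathComponents) (componentOf-otherEnd leaf) (∈-map⁺ componentOf (∈-representatives⁺ rep))

  ∈-pathComponents⁺ : ∀ {C} → IsPathComponent E C → C ∈ₗ pathComponents
  ∈-pathComponents⁺ pathC with IsPathComponent⇒leaf pathC
  ... | a , leaf , a∈C = subst (_∈ₗ pathComponents)
    (IsComponent-unique (FromLeaf.isComponent leaf) (proj₁ pathC) (FromLeaf.u∈componentOf leaf) a∈C)
    (componentOf∈pathComponents leaf)

  ∈-pathComponents⁻ : ∀ {C} → C ∈ₗ pathComponents → IsPathComponent E C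
  ∈-pathComponents⁻ C∈ with ∈-map⁻ componentOf C∈
  ... | u , u∈ , refl = FromLeaf.isPathComponent (proj₁ (∈-representatives⁻ u∈))

  Unique-pathComponents : Unique pathComponents
  Unique-pathComponents = Unique-map⁺-on componentOf injective (Unique.filter⁺ representative? (Unique.allFin⁺ n))
    where
    injective : ∀ {x y} → x ∈ₗ representatives → y ∈ₗ representatives → componentOf x ≡ componentOf y → x ≡ y
    injective {x} {y} x∈ y∈ eq with ∈-representatives⁻ x∈ | ∈-representatives⁻ y∈
    ... | repx@(leafx , _) | repy@(leafy , _) with FromLeaf.leaf-on-path leafx
            (∈-toSubset⁻ (pathFrom x) (subst (y ∈_) (sym eq) (FromLeaf.u∈componentOf leafy))) leafy
    ...   | inj₁ y≡x  = sym y≡x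
    ...   | inj₂ refl = ⊥-elim (representative⇒¬representative-otherEnd repx repy)

  private
    Nonrepresentative? : ∀ u → Dec (Leaf u × ¬ toℕ u < toℕ (otherEnd u))
    Nonrepresentative? u = Leaf? u ×-dec ¬? (toℕ u <? toℕ (otherEnd u))

  otherEnd-representatives↭ : map otherEnd representatives ↭ filter Nonrepresentative? (allFin n)
  otherEnd-representatives↭ = Unique-sameMembers⇒↭
    (Unique-map⁺-on otherEnd injective (Unique.filter⁺ representative? (Unique.allFin⁺ n)))
    (Unique.filter⁺ Nonrepresentative? (Unique.allFin⁺ n)) to from
    where
    injective : ∀ {x y} → x ∈ₗ representatives → y ∈ₗ representatives → otherEnd x ≡ otherEnd y → x ≡ y
    injective x∈ y∈ eq = trans (sym (otherEnd-involutive (proj₁ (∈-representatives⁻ x∈))))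
                           (trans (cong otherEnd eq) (otherEnd-involutive (proj₁ (∈-representatives⁻ y∈))))
    to : ∀ {z} → z ∈ₗ map otherEnd representatives → z ∈ₗ filter Nonrepresentative? (allFin n)
    to z∈ with ∈-map⁻ otherEnd z∈
    ... | x , x∈ , refl with ∈-representatives⁻ x∈
    ...   | rep@(leaf , _) = ∈-filter⁺ Nonrepresentative? (∈-allFin (otherEnd x)) (leaf′ , λ v< →
                               representative⇒¬representative-otherEnd rep (leaf′ , v<))
      where leaf′ = FromLeaf.otherEnd-leaf leaf
    from : ∀ {z} → z ∈ₗ filter Nonrepresentative? (allFin n) → z ∈ₗ map otherEnd representatives
    from {z} z∈ with proj₂ (∈-filter⁻ Nonrepresentative? {xs = allFin n} z∈)
    ... | leaf , z≮ with leaf⇒representative leaf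
    ...   | inj₁ (_ , z<) = ⊥-elim (z≮ z<)
    ...   | inj₂ rep = subst (_∈ₗ map otherEnd representatives) (otherEnd-involutive leaf)
                         (∈-map⁺ otherEnd (∈-representatives⁺ rep))

  length-pathComponents : length pathComponents * 2 ≡ length (filter Leaf? (allFin n))
  length-pathComponents = begin
    length pathComponents * 2                                       ≡⟨ cong (_* 2) (length-map componentOf representatives) ⟩
    length representatives * 2                                      ≡⟨ m*2≡m+m (length representatives) ⟩
    length representatives + length representatives
      ≡⟨ cong (length representatives +_) (sym (length-map otherEnd representatives)) ⟩
    length representatives + length (map otherEnd representatives)
      ≡⟨ cong (length representatives +_) (↭-length otherEnd-representatives↭) ⟩
    length representatives + length (filter Nonrepresentative? (allFin n))
      ≡⟨ length-filter-split Leaf? (λ u → toℕ u <? toℕ (otherEnd u)) (allFin n) ⟨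
    length (filter Leaf? (allFin n))                                ∎
    where open ≡-Reasoning

-- The matchings h(S)

outDegree-zip : ∀ (v : Fin n) xs ys → length xs ≤ length ys → outDegree (zip xs ys) v ≡ occurrences v xs
outDegree-zip v []       ys       _           = refl
outDegree-zip v (x ∷ xs) (y ∷ ys) (s≤s xs≤ys) with x ≟ᶠ v
... | yes _ = cong suc (outDegree-zip v xs ys xs≤ys)
... | no _  = outDegree-zip v xs ys xs≤ys

inDegree-zip : ∀ (v : Fin n) xs ys → length ys ≤ length xs → inDegree (zip xs ys) v ≡ occurrences v ys
inDegree-zip v []       []       _           = refl
inDegree-zip v (_ ∷ _)  []       _           = refl
inDegree-zip v (x ∷ xs) (y ∷ ys) (s≤s ys≤xs) with y ≟ᶠ v
... | yes _ = cong suc (inDegree-zip v xs ys ys≤xs)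
... | no _  = inDegree-zip v xs ys ys≤xs

degree-zip : ∀ (xs ys : List (Fin n)) → length xs ≡ length ys →
  ∀ v → degree (zip xs ys) v ≡ occurrences v xs + occurrences v ys
degree-zip xs ys |xs|≡|ys| v =
  cong₂ _+_ (outDegree-zip v xs ys (≤-reflexive |xs|≡|ys|)) (inDegree-zip v xs ys (≤-reflexive (sym |xs|≡|ys|)))

does-≤?≡not-does-<? : ∀ k m → does (k ≤? m) ≡ not (does (m <? k))
does-≤?≡not-does-<? k m with m <? k
... | yes m<k = trans (dec-false (k ≤? m) (<⇒≱ m<k)) (cong not (sym (dec-true (m <? k) m<k)))
... | no m≮k  = trans (dec-true (k ≤? m) (≮⇒≥ m≮k)) (cong not (sym (dec-false (m <? k) m≮k)))

indicator-∧-not+indicator-not-∧ : ∀ a c → indicator (a ∧ not c) + indicator (not a ∧ c) ≡ indicator (a xor c)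
indicator-∧-not+indicator-not-∧ true  true  = refl
indicator-∧-not+indicator-not-∧ true  false = refl
indicator-∧-not+indicator-not-∧ false true  = refl
indicator-∧-not+indicator-not-∧ false false = refl

module _ (k : ℕ) (S : Subset n) where

  private
    upper? : Decidable (λ i → i ∈ S × k ≤ toℕ i)
    upper? i = i ∈? S ×-dec k ≤? toℕ i
    lower? : Decidable (λ i → i ∉ S × toℕ i < k)
    lower? i = ¬? (i ∈? S) ×-dec toℕ i <? k

  length-upperPart≡length-lowerPart : k ≤ n → ∣ S ∣ ≡ k → length (upperPart k S) ≡ length (lowerPart k S)
  length-upperPart≡length-lowerPart k≤n ∣S∣≡k = +-cancelˡ-≡ (count S∩[k]?) _ _ (begin
    count S∩[k]? + length (upperPart k S)              ≡⟨ cong (count S∩[k]? +_) (length-reverse (filter upper? (allFin n))) ⟩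
    count S∩[k]? + count upper?
      ≡⟨ cong (count S∩[k]? +_) (cong length (filter-≐ S─[k]? upper? (map₂ ≮⇒≥ , map₂ ≤⇒≯) (allFin n))) ⟨
    count S∩[k]? + count S─[k]?                        ≡⟨ length-filter-split (_∈? S) [k]? (allFin n) ⟨
    count (_∈? S)                                      ≡⟨ trans (sym (∣p∣≡length-filter-∈ S)) ∣S∣≡k ⟩
    k                                                  ≡⟨ length-filter-<-allFin k k≤n ⟨
    count [k]?                                         ≡⟨ length-filter-split [k]? (_∈? S) (allFin n) ⟩
    count [k]∩S? + count [k]─S?                        ≡⟨ cong₂ _+_ (count-swap [k]∩S? S∩[k]?) (count-swap [k]─S? lower?) ⟩
    count S∩[k]? + length (lowerPart k S)              ∎)
    where
    open ≡-Reasoning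
    count : ∀ {P : Pred (Fin n) p} → Decidable P → ℕ
    count P? = length (filter P? (allFin n))
    count-swap : ∀ {P Q : Pred (Fin n) p} (P? : Decidable (λ i → P i × Q i)) (Q? : Decidable (λ i → Q i × P i)) →
                 count P? ≡ count Q?
    count-swap P? Q? = cong length (filter-≐ P? Q? (swap , swap) (allFin n))
    [k]? : Decidable (λ i → toℕ i < k)
    [k]? i = toℕ i <? k
    S∩[k]? : Decidable (λ i → i ∈ S × toℕ i < k)
    S∩[k]? i = i ∈? S ×-dec [k]? i
    S─[k]? : Decidable (λ i → i ∈ S × ¬ toℕ i < k)
    S─[k]? i = i ∈? S ×-dec ¬? ([k]? i)
    [k]∩S? : Decidable (λ i → toℕ i < k × i ∈ S)
    [k]∩S? i = [k]? i ×-dec i ∈? S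
    [k]─S? : Decidable (λ i → toℕ i < k × i ∉ S)
    [k]─S? i = [k]? i ×-dec ¬? (i ∈? S)

  degree-f : k ≤ n → ∣ S ∣ ≡ k → ∀ v → degree (f k S) v ≡ indicator (does (v ∈? S) xor does (toℕ v <? k))
  degree-f k≤n ∣S∣≡k v = begin
    degree (f k S) v
      ≡⟨ degree-zip (upperPart k S) (lowerPart k S) (length-upperPart≡length-lowerPart k≤n ∣S∣≡k) v ⟩
    occurrences v (upperPart k S) + occurrences v (lowerPart k S)
      ≡⟨ cong₂ _+_ (trans (occurrences-reverse v (filter upper? (allFin n))) (occurrences-filter-allFin upper? v))
                   (occurrences-filter-allFin lower? v) ⟩
    indicator (v∈S ∧ does (k ≤? toℕ v)) + indicator (not v∈S ∧ v<k)
      ≡⟨ cong (λ b → indicator (v∈S ∧ b) + indicator (not v∈S ∧ v<k)) (does-≤?≡not-does-<? k (toℕ v)) ⟩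
    indicator (v∈S ∧ not v<k) + indicator (not v∈S ∧ v<k)
      ≡⟨ indicator-∧-not+indicator-not-∧ v∈S v<k ⟩
    indicator (v∈S xor v<k) ∎
    where
    open ≡-Reasoning
    v∈S v<k : Bool
    v∈S = does (v ∈? S)
    v<k = does (toℕ v <? k)

indicator≤1 : ∀ b → indicator b ≤ 1
indicator≤1 true  = s≤s z≤n
indicator≤1 false = z≤n

indicator-xor+indicator-xor≡1⇔ : ∀ a b c → indicator (a xor c) + indicator (b xor c) ≡ 1 ⇔ Bool.T (a xor b)
indicator-xor+indicator-xor≡1⇔ true  true  true  = mk⇔ (λ ()) (λ ())
indicator-xor+indicator-xor≡1⇔ true  true  false = mk⇔ (λ ()) (λ ())
indicator-xor+indicator-xor≡1⇔ true  false true  = mk⇔ _ (λ _ → refl)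
indicator-xor+indicator-xor≡1⇔ true  false false = mk⇔ _ (λ _ → refl)
indicator-xor+indicator-xor≡1⇔ false true  true  = mk⇔ _ (λ _ → refl)
indicator-xor+indicator-xor≡1⇔ false true  false = mk⇔ _ (λ _ → refl)
indicator-xor+indicator-xor≡1⇔ false false true  = mk⇔ (λ ()) (λ ())
indicator-xor+indicator-xor≡1⇔ false false false = mk⇔ (λ ()) (λ ())

module _ {n} {k : ℕ} (k≤n : k ≤ n) where

  isMatching-f : ∀ {S : Subset n} → ∣ S ∣ ≡ k → IsMatching (f k S)
  isMatching-f {S} ∣S∣≡k v = subst (_≤ 1) (sym (degree-f k S k≤n ∣S∣≡k v)) (indicator≤1 _)

  degree-h≡1⇔∈Δ : ∀ {S T : Subset n} → ∣ S ∣ ≡ k → ∣ T ∣ ≡ k →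
                  ∀ v → degree (hEdges k S T) v ≡ 1 ⇔ v ∈ S Δ T
  degree-h≡1⇔∈Δ {S} {T} ∣S∣≡k ∣T∣≡k v = subst (λ d → d ≡ 1 ⇔ v ∈ S Δ T) (sym degree≡)
    (⇔.trans (indicator-xor+indicator-xor≡1⇔ (does (v ∈? S)) (does (v ∈? T)) (does (toℕ v <? k))) (⇔.sym (∈Δ⇔xor S T)))
    where
    degree≡ : degree (hEdges k S T) v ≡
              indicator (does (v ∈? S) xor does (toℕ v <? k)) + indicator (does (v ∈? T) xor does (toℕ v <? k))
    degree≡ = trans (degree-++ (f k S) (f k T) v) (cong₂ _+_ (degree-f k S k≤n ∣S∣≡k v) (degree-f k T k≤n ∣T∣≡k v))

mainTheorem3 : (n k : ℕ) → 1 ≤ k → k ≤ n → (S T : Subset n) →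
    ∣ S ∣ ≡ k → ∣ T ∣ ≡ k → ¬ (S ≡ T) →
    (∀ v → (degree (hEdges k S T) v ≡ 1 ⇔ v ∈ (S Δ T)))
    × Σ (List (Subset n)) (λ L →
        Unique L
        × (∀ C → (C LM.∈ L ⇔ IsPathComponent (hEdges k S T) C))
        × (length L * 2 ≡ ∣ S Δ T ∣)
        × (length L ≡ ∣ S ─ T ∣)
        × (length L ≡ ∣ T ─ S ∣))
mainTheorem3 n k _ k≤n S T ∣S∣≡k ∣T∣≡k _ =
  leaf⇔∈Δ , pathComponents , Unique-pathComponents , (λ C → mk⇔ ∈-pathComponents⁻ ∈-pathComponents⁺) ,
  twice , half , trans half ∣S─T∣≡∣T─S∣
  where
  open MatchingUnion (f k S) (f k T) (isMatching-f k≤n ∣S∣≡k) (isMatching-f k≤n ∣T∣≡k)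
  leaf⇔∈Δ : ∀ v → Leaf v ⇔ v ∈ S Δ T
  leaf⇔∈Δ = degree-h≡1⇔∈Δ k≤n ∣S∣≡k ∣T∣≡k
  ∣S─T∣≡∣T─S∣ : ∣ S ─ T ∣ ≡ ∣ T ─ S ∣
  ∣S─T∣≡∣T─S∣ = ∣p∣≡∣q∣⇒∣p─q∣≡∣q─p∣ S T (trans ∣S∣≡k (sym ∣T∣≡k))
  twice : length pathComponents * 2 ≡ ∣ S Δ T ∣
  twice = trans length-pathComponents (length-filter≡∣p∣ Leaf? (S Δ T) leaf⇔∈Δ)
  half : length pathComponents ≡ ∣ S ─ T ∣
  half = *-cancelʳ-≡ _ _ 2 (begin
    length pathComponents * 2   ≡⟨ twice ⟩
    ∣ S Δ T ∣                   ≡⟨ ∣pΔq∣≡∣p─q∣+∣q─p∣ S T ⟩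
    ∣ S ─ T ∣ + ∣ T ─ S ∣       ≡⟨ cong (∣ S ─ T ∣ +_) (sym ∣S─T∣≡∣T─S∣) ⟩
    ∣ S ─ T ∣ + ∣ S ─ T ∣       ≡⟨ m*2≡m+m ∣ S ─ T ∣ ⟨
    ∣ S ─ T ∣ * 2               ∎)
    where open ≡-Reasoning
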